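{- Let $T$ and $T'$ be unrooted binary phylogenetic $X$-trees. Let $f_2$ be a two-state character with $|l_{f_2}(T)-l_{f_2}(T')|=d^2_{MP}(T,T')$, let $T^{*}\in\{T,T'\}$, and let $g_2$ be an optimal extension of $f_2$ to $T^{*}$ such that every connected component of the forest obtained from $T^{*}$ by deleting the mutation edges of $g_2$ contains at least two taxa. Let $f_c$ be the character on $X$ (partition of $X$) whose blocks are the sets of taxa in the connected components of this forest. Then $f_c$ is convex on $T^{*}$, and the natural partial extension of $f_c$ to $T^{*}$ assigns a state to every vertex of $T^{*}$ (it is a natural covering extension).
   Context: An unrooted binary phylogenetic $X$-tree: internal vertices of degree 3, leaves bijectively labelled by $X$. A character is a surjective $f:X\to\mathcal{C}$, identified with the partition of $X$ it induces. An extension $h:V(T)\to\mathcal{C}$ agrees with $f$ on $X$; $l_h(T)$ counts edges $\{u,v\}$ with $h(u)\neq h(v)$ (mutation edges); $l_f(T)=\min_h l_h(T)$; $h$ is optimal if $l_h(T)=l_f(T)$. $d^2_{MP}(T,T')=\max_f|l_f(T)-l_f(T')|$ over two-state characters. A character is convex on $T$ if the minimal subtrees spanning its blocks are pairwise vertex-disjoint. The natural partial extension of a convex character assigns to each vertex of the minimal subtree spanning a block the state of that block, leaving other vertices unassigned. -}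

module Defs where

open import Data.Nat using (ℕ; zero; suc; _+_; _≤_; _⊓_; _<ᵇ_; ∣_-_∣)
open import Data.Fin using (Fin; zero; suc; toℕ; _↑ˡ_; _↑ʳ_; inject₁; fromℕ; splitAt; _≟_)
open import Data.Vec using (Vec; []; _∷_; lookup; replicate)
open import Data.List using (List; []; _∷_; length; filterᵇ; allFin; map; concatMap; foldr)
open import Data.Bool using (Bool; true; false; _∧_; not; T)
open import Data.Sum using (_⊎_; [_,_]′)
open import Data.Product using (Σ; ∃; _×_; _,_)
open import Relation.Binary.PropositionalEquality using (_≡_)
open import Relation.Nullary using (¬_)
open import Relation.Nullary.Decidable using (⌊_⌋)
open import Function.Definitions using (Injective)

data Walk {V : ℕ} (E : Fin V → Fin V → Set) (S : Fin V → Set)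
          : Fin V → Fin V → Set where
  here : ∀ {u} → S u → Walk E S u u
  step : ∀ {u w v} → S u → E u w → Walk E S w v → Walk E S u v

Everything : {V : ℕ} → Fin V → Set
Everything _ = Bool

IsCycle : {V : ℕ} → (Fin V → Fin V → Bool) → (k : ℕ) → (Fin (suc (suc (suc k))) → Fin V) → Set
IsCycle adj k c =
  Injective _≡_ _≡_ c ×
  (∀ (i : Fin (suc (suc k))) → T (adj (c (inject₁ i)) (c (suc i)))) ×
  T (adj (c (fromℕ (suc (suc k)))) (c zero))

degree : {V : ℕ} → (Fin V → Fin V → Bool) → Fin V → ℕ
degree {V} adj u = length (filterᵇ (adj u) (allFin V))

-- Unrooted binary phylogenetic X-trees, X = Fin n.
-- Vertex set Fin (n + m): the vertex  i ↑ˡ m  is the leaf labelled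
-- by taxon i; the vertices  n ↑ʳ j  are the m internal vertices.

record PhyloTree (n : ℕ) : Set where
  field
    m         : ℕ
    adj       : Fin (n + m) → Fin (n + m) → Bool
    adj-sym   : ∀ u v → adj u v ≡ adj v u
    adj-irr   : ∀ u → adj u u ≡ false
    connected : ∀ u v → Walk (λ a b → T (adj a b)) Everything u v
    acyclic   : ∀ k c → ¬ IsCycle adj k c
    leafDeg   : ∀ i → degree adj (i ↑ˡ m) ≤ 1
    innerDeg  : ∀ j → degree adj (n ↑ʳ j) ≡ 3

open PhyloTree public

Vtx : ∀ {n} → PhyloTree n → ℕ
Vtx {n} t = n + m t

leaf : ∀ {n} (t : PhyloTree n) → Fin n → Fin (Vtx t)
leaf t i = i ↑ˡ m t

Edge : ∀ {n} (t : PhyloTree n) → Fin (Vtx t) → Fin (Vtx t) → Set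
Edge t u v = T (adj t u v)

IsSurjective : ∀ {n k} → (Fin n → Fin k) → Set
IsSurjective {n} {k} f = ∀ (c : Fin k) → ∃ λ (x : Fin n) → f x ≡ c

IsExtension : ∀ {n k} (t : PhyloTree n) → (Fin n → Fin k) → (Fin (Vtx t) → Fin k) → Set
IsExtension t f h = ∀ i → h (leaf t i) ≡ f i

allPairs : (V : ℕ) → List (Fin V × Fin V)
allPairs V = concatMap (λ u → map (λ v → (u , v)) (allFin V)) (allFin V)

-- l_h(t): number of (unordered) edges {u,v} with h u ≠ h v
changes : ∀ {n k} (t : PhyloTree n) → (Fin (Vtx t) → Fin k) → ℕ
changes t h = length (filterᵇ p (allPairs (Vtx t)))
  where
  p : _ → Bool
  p (u , v) = (toℕ u <ᵇ toℕ v) ∧ adj t u v ∧ not ⌊ h u ≟ h v ⌋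

allVecs : (m : ℕ) → List (Vec (Fin 2) m)
allVecs zero    = [] ∷ []
allVecs (suc m) = concatMap (λ b → map (b ∷_) (allVecs m)) (allFin 2)

extend : ∀ {n} (t : PhyloTree n) → (Fin n → Fin 2) → Vec (Fin 2) (m t) → Fin (Vtx t) → Fin 2
extend {n} t f v x = [ f , lookup v ]′ (splitAt n x)

-- l_f(t) for a two-state character f: minimum of l_h(t) over all extensions h
score : ∀ {n} (t : PhyloTree n) → (Fin n → Fin 2) → ℕ
score t f = foldr (λ v acc → changes t (extend t f v) ⊓ acc)
                  (changes t (extend t f (replicate (m t) zero)))
                  (allVecs (m t))

IsOptimal : ∀ {n} (t : PhyloTree n) → (Fin n → Fin 2) → (Fin (Vtx t) → Fin 2) → Set
IsOptimal t f h = IsExtension t f h × changes t h ≡ score t f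

-- |l_f(T) - l_f(T')| = d^2_MP(T,T'), i.e. f attains the maximum over all
-- two-state characters g of |l_g(T) - l_g(T')|
AttainsDMP2 : ∀ {n} (t t' : PhyloTree n) → (Fin n → Fin 2) → Set
AttainsDMP2 {n} t t' f =
  ∀ (g : Fin n → Fin 2) → IsSurjective g →
    ∣ score t g - score t' g ∣ ≤ ∣ score t f - score t' f ∣

-- u and v lie in the same component of the forest  t minus mutation edges of h
SameComp : ∀ {n k} (t : PhyloTree n) → (Fin (Vtx t) → Fin k) → Fin (Vtx t) → Fin (Vtx t) → Set
SameComp t h = Walk (λ a b → Edge t a b × h a ≡ h b) Everything

ComponentsHaveTwoTaxa : ∀ {n k} (t : PhyloTree n) → (Fin (Vtx t) → Fin k) → Set
ComponentsHaveTwoTaxa {n} t h =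
  ∀ v → Σ (Fin n) λ x → Σ (Fin n) λ y →
    ¬ x ≡ y × SameComp t h v (leaf t x) × SameComp t h v (leaf t y)

-- Characters given as partitions (equivalence relations R on X: R x y
-- means x and y are in the same block)

Partition : ℕ → Set₁
Partition n = Fin n → Fin n → Set

componentPartition : ∀ {n k} (t : PhyloTree n) → (Fin (Vtx t) → Fin k) → Partition n
componentPartition t h x y = SameComp t h (leaf t x) (leaf t y)

ConnectedSet : ∀ {n} (t : PhyloTree n) → (Fin (Vtx t) → Bool) → Set
ConnectedSet t S = ∀ u v → T (S u) → T (S v) → Walk (Edge t) (λ a → T (S a)) u v

-- v lies in the minimal subtree of t spanning the block of x, i.e. in every
-- subtree (connected vertex set) containing all leaves of that block
InSpan : ∀ {n} (t : PhyloTree n) → Partition n → Fin n → Fin (Vtx t) → Set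
InSpan t R x v =
  ∀ (S : Fin (Vtx t) → Bool) → ConnectedSet t S →
    (∀ y → R x y → T (S (leaf t y))) → T (S v)

-- convex: minimal subtrees spanning distinct blocks are vertex-disjoint
Convex : ∀ {n} (t : PhyloTree n) → Partition n → Set
Convex t R = ∀ x y v → InSpan t R x v → InSpan t R y v → R x y

-- the natural partial extension (state of the block on its minimal spanning
-- subtree) assigns a state to every vertex
NaturalCovering : ∀ {n} (t : PhyloTree n) → Partition n → Set
NaturalCovering {n} t R = ∀ v → Σ (Fin n) λ x → InSpan t R x v

{-# OPTIONS --safe #-}
-- Convexity holds for the components of any extension h: the component of a leaf is a
-- connected vertex set containing its whole block, hence contains the span of that block,
-- so spans of different blocks lie in different components.
--
-- For the covering, let v lie in the component of taxon x and let S be a subtree containing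
-- the block of x. If v were outside S, some same-state edge q p of the component would leave
-- S at q. An optimal h gives every internal vertex a second same-state neighbour: flipping
-- the state of a degree-3 vertex with at most one such neighbour removes a mutation edge.
-- So the path p q extends, inside the component, one vertex at a time; acyclicity and the
-- connectedness of S keep each new vertex off the path and outside S. A simple path cannot
-- grow beyond the number of vertices, a contradiction.
module Submission where

open import Defs
open import Data.Bool using (Bool; true; false; _∧_; _∨_; not; T; if_then_else_)
open import Data.Bool.Properties using (T-∧; T-∨; T?; ∧-comm; ∧-zeroʳ; ∧-identityʳ)
open import Data.Empty using (⊥; ⊥-elim)
open import Data.Fin using (Fin; zero; suc; toℕ; _≟_; _↑ˡ_; _↑ʳ_; splitAt; inject₁; fromℕ)
open import Data.Fin.Properties using (any?; toℕ-injective; injective⇒≤;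
  splitAt-↑ˡ; splitAt-↑ʳ; splitAt⁻¹-↑ˡ; splitAt⁻¹-↑ʳ)
open import Data.List using (List; []; _∷_; length; _++_; map; concatMap; allFin; filterᵇ; foldr; lookup)
open import Data.List.Properties using (map-tabulate; ++-assoc)
open import Data.List.Membership.Propositional using (_∈_; _∉_)
open import Data.List.Membership.Propositional.Properties using (∈-map⁺; ∈-++⁺ˡ; ∈-++⁺ʳ; ∈-++⁻; ∈-lookup)
open import Data.List.Relation.Unary.Any using (here; there)
open import Data.Nat using (ℕ; zero; suc; _+_; _*_; _≤_; _<_; _<ᵇ_; _⊓_; _≤′_; ≤′-refl; ≤′-step; z≤n; s≤s)
open import Data.Nat.Properties using (+-assoc; +-suc; +-identityʳ; +-monoˡ-<; n≤1+n; ≤-trans; ≤-reflexive;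
  <ᵇ⇒<; <⇒<ᵇ; <-asym; <-cmp; <⇒≱; m⊓n≤m; m⊓n≤n; ≤⇒≤′)
open import Data.Product using (∃; ∃₂; ∃-syntax; _×_; _,_; proj₁; proj₂)
open import Data.Sum using (_⊎_; inj₁; inj₂; [_,_]′)
open import Data.Vec using (Vec; []; _∷_; tabulate)
open import Data.Vec.Properties using (lookup∘tabulate)
open import Function using (_∘_; id; Equivalence)
open import Relation.Binary.Definitions using (tri<; tri≈; tri>)
open import Relation.Binary.PropositionalEquality
open import Relation.Nullary using (¬_; Dec; yes; no)
open import Relation.Nullary.Decidable using (⌊_⌋; toWitness; fromWitness; _×-dec_; ¬?)

_==_ : ∀ {N} → Fin N → Fin N → Bool
a == b = ⌊ a ≟ b ⌋

module _ {N : ℕ} where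

  ==-refl : ∀ (a : Fin N) → (a == a) ≡ true
  ==-refl a with a ≟ a
  ... | yes _ = refl
  ... | no a≢a = ⊥-elim (a≢a refl)

  ==-≢ : ∀ {a b : Fin N} → a ≢ b → (a == b) ≡ false
  ==-≢ {a} {b} a≢b with a ≟ b
  ... | yes a≡b = ⊥-elim (a≢b a≡b)
  ... | no _ = refl

  ==-sym : ∀ (a b : Fin N) → (a == b) ≡ (b == a)
  ==-sym a b with a ≟ b
  ... | yes refl = sym (==-refl a)
  ... | no a≢b = sym (==-≢ (a≢b ∘ sym))

countᵇ : {A : Set} → (A → Bool) → List A → ℕ
countᵇ p [] = 0
countᵇ p (x ∷ xs) = if p x then suc (countᵇ p xs) else countᵇ p xs

module _ {A : Set} where

  length-filterᵇ : ∀ (p : A → Bool) xs → length (filterᵇ p xs) ≡ countᵇ p xs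
  length-filterᵇ p [] = refl
  length-filterᵇ p (x ∷ xs) with p x
  ... | true = cong suc (length-filterᵇ p xs)
  ... | false = length-filterᵇ p xs

  countᵇ-cong : ∀ {p q : A → Bool} → (∀ x → p x ≡ q x) → ∀ xs → countᵇ p xs ≡ countᵇ q xs
  countᵇ-cong p≗q [] = refl
  countᵇ-cong {q = q} p≗q (x ∷ xs) rewrite p≗q x with q x
  ... | true = cong suc (countᵇ-cong p≗q xs)
  ... | false = countᵇ-cong p≗q xs

  countᵇ-split : ∀ (p q : A → Bool) xs →
    countᵇ p xs ≡ countᵇ (λ x → p x ∧ q x) xs + countᵇ (λ x → p x ∧ not (q x)) xs
  countᵇ-split p q [] = refl
  countᵇ-split p q (x ∷ xs) with p x | q x
  ... | true | true = cong suc (countᵇ-split p q xs)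
  ... | true | false = trans (cong suc (countᵇ-split p q xs)) (sym (+-suc _ _))
  ... | false | _ = countᵇ-split p q xs

  countᵇ-mono : ∀ {p q : A → Bool} → (∀ x → T (p x) → T (q x)) → ∀ xs → countᵇ p xs ≤ countᵇ q xs
  countᵇ-mono p⇒q [] = z≤n
  countᵇ-mono {p} {q} p⇒q (x ∷ xs) with p x | q x | p⇒q x
  ... | true | true | _ = s≤s (countᵇ-mono p⇒q xs)
  ... | true | false | p⇒q-x = ⊥-elim (p⇒q-x _)
  ... | false | true | _ = ≤-trans (countᵇ-mono p⇒q xs) (n≤1+n _)
  ... | false | false | _ = countᵇ-mono p⇒q xs

  countᵇ-++ : ∀ (p : A → Bool) xs ys → countᵇ p (xs ++ ys) ≡ countᵇ p xs + countᵇ p ys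
  countᵇ-++ p [] ys = refl
  countᵇ-++ p (x ∷ xs) ys with p x
  ... | true = cong suc (countᵇ-++ p xs ys)
  ... | false = countᵇ-++ p xs ys

  countᵇ-false : ∀ (xs : List A) → countᵇ (λ _ → false) xs ≡ 0
  countᵇ-false [] = refl
  countᵇ-false (_ ∷ xs) = countᵇ-false xs

countᵇ-map : ∀ {A B : Set} (p : B → Bool) (g : A → B) xs → countᵇ p (map g xs) ≡ countᵇ (p ∘ g) xs
countᵇ-map p g [] = refl
countᵇ-map p g (x ∷ xs) with p (g x)
... | true = cong suc (countᵇ-map p g xs)
... | false = countᵇ-map p g xs

allFin-suc : ∀ n → allFin (suc n) ≡ zero ∷ map suc (allFin n)
allFin-suc n = cong (zero ∷_) (sym (map-tabulate id suc))

countᵇ-allFin-== : ∀ {n} (w : Fin n) → countᵇ (_== w) (allFin n) ≡ 1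
countᵇ-allFin-== {suc n} w = trans (cong (countᵇ (_== w)) (allFin-suc n)) (count-from-zero w)
  where
  count-from-zero : ∀ w → countᵇ (_== w) (zero ∷ map suc (allFin n)) ≡ 1
  count-from-zero zero = cong suc (trans (countᵇ-map (_== zero) suc (allFin n)) (countᵇ-false (allFin n)))
  count-from-zero (suc w) =
    trans (countᵇ-map (_== suc w) suc (allFin n)) (trans (countᵇ-cong suc==suc (allFin n)) (countᵇ-allFin-== w))
    where
    suc==suc : ∀ v → (suc v == suc w) ≡ (v == w)
    suc==suc v with v ≟ w
    ... | yes _ = refl
    ... | no _ = refl

touches : ∀ {V} → Fin V → Fin V × Fin V → Bool
touches w (u , v) = u == w ∨ v == w

allPairs-from : ∀ {V} → List (Fin V) → List (Fin V × Fin V)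
allPairs-from {V} = concatMap (λ u → map (u ,_) (allFin V))

module _ {V : ℕ} (Q : Fin V × Fin V → Bool) (w : Fin V) where

  private
    Qₜ : Fin V × Fin V → Bool
    Qₜ e = Q e ∧ touches w e

    out-degree : ℕ
    out-degree = countᵇ (λ v → Q (w , v)) (allFin V)

    countᵇ-row-at : countᵇ (Qₜ ∘ (w ,_)) (allFin V) ≡ out-degree
    countᵇ-row-at = countᵇ-cong Qₜ-at (allFin V)
      where
      Qₜ-at : ∀ v → Qₜ (w , v) ≡ Q (w , v)
      Qₜ-at v rewrite ==-refl w = ∧-identityʳ (Q (w , v))

    countᵇ-row-away : ∀ {u} → u ≢ w → countᵇ (Qₜ ∘ (u ,_)) (allFin V) ≡ countᵇ (λ u → Q (u , w)) (u ∷ [])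
    countᵇ-row-away {u} u≢w = begin
        countᵇ (Qₜ ∘ (u ,_)) (allFin V)             ≡⟨ countᵇ-cong only-w (allFin V) ⟩
        countᵇ (λ v → Q (u , w) ∧ (v == w)) (allFin V) ≡⟨ at-most-w (Q (u , w)) ⟩
        countᵇ (λ u → Q (u , w)) (u ∷ [])            ∎
      where
      open ≡-Reasoning
      only-w : ∀ v → Qₜ (u , v) ≡ Q (u , w) ∧ (v == w)
      only-w v rewrite ==-≢ u≢w with v ≟ w
      ... | yes refl = refl
      ... | no _ = trans (∧-zeroʳ _) (sym (∧-zeroʳ _))
      at-most-w : ∀ b → countᵇ (λ v → b ∧ (v == w)) (allFin V) ≡ (if b then 1 else 0)
      at-most-w true = countᵇ-allFin-== w
      at-most-w false = countᵇ-false (allFin V)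

    countᵇ-rows : Q (w , w) ≡ false → ∀ xs →
      countᵇ Qₜ (allPairs-from xs) ≡ countᵇ (_== w) xs * out-degree + countᵇ (λ u → Q (u , w)) xs
    countᵇ-rows Qww [] = refl
    countᵇ-rows Qww (u ∷ xs) with u ≟ w
    ... | yes refl
      rewrite countᵇ-++ Qₜ (map (w ,_) (allFin V)) (allPairs-from xs)
            | countᵇ-map Qₜ (w ,_) (allFin V) | countᵇ-row-at | countᵇ-rows Qww xs | Qww
            = sym (+-assoc out-degree _ _)
    ... | no u≢w
      rewrite countᵇ-++ Qₜ (map (u ,_) (allFin V)) (allPairs-from xs)
            | countᵇ-map Qₜ (u ,_) (allFin V) | countᵇ-row-away u≢w | countᵇ-rows Qww xs
            with Q (u , w)
    ... | true = sym (+-suc _ _)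
    ... | false = refl

  countᵇ-touching : Q (w , w) ≡ false →
    countᵇ (λ e → Q e ∧ touches w e) (allPairs V) ≡
    countᵇ (λ v → Q (w , v)) (allFin V) + countᵇ (λ u → Q (u , w)) (allFin V)
  countᵇ-touching Qww rewrite countᵇ-rows Qww (allFin V) | countᵇ-allFin-== w =
    cong (_+ countᵇ (λ u → Q (u , w)) (allFin V)) (+-identityʳ out-degree)

<ᵇ-flip : ∀ {a b} → a ≢ b → not (a <ᵇ b) ≡ (b <ᵇ a)
<ᵇ-flip {a} {b} a≢b with a <ᵇ b in a<b | b <ᵇ a in b<a
... | true | true = ⊥-elim (<-asym (<ᵇ⇒< a b (subst T (sym a<b) _)) (<ᵇ⇒< b a (subst T (sym b<a) _)))
... | true | false = refl
... | false | true = refl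
... | false | false with <-cmp a b
...   | tri< lt _ _ = ⊥-elim (subst T a<b (<⇒<ᵇ lt))
...   | tri≈ _ eq _ = ⊥-elim (a≢b eq)
...   | tri> _ _ gt = ⊥-elim (subst T b<a (<⇒<ᵇ gt))

precedes : ∀ {V} → Fin V → Fin V → Bool
precedes u v = toℕ u <ᵇ toℕ v

precedes-flip : ∀ {V} {u v : Fin V} → u ≢ v → not (precedes u v) ≡ precedes v u
precedes-flip u≢v = <ᵇ-flip (u≢v ∘ toℕ-injective)

otherState : Fin 2 → Fin 2
otherState zero = suc zero
otherState (suc zero) = zero

not-otherState-== : ∀ a b → not (otherState a == b) ≡ (a == b)
not-otherState-== zero zero = refl
not-otherState-== zero (suc zero) = refl
not-otherState-== (suc zero) zero = refl
not-otherState-== (suc zero) (suc zero) = refl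

flipAt : ∀ {V} → (Fin V → Fin 2) → Fin V → Fin V → Fin 2
flipAt h w u = if u == w then otherState (h w) else h u

flipAt-away : ∀ {V} (h : Fin V → Fin 2) {w u} → u ≢ w → flipAt h w u ≡ h u
flipAt-away h u≢w rewrite ==-≢ u≢w = refl

flipAt-at : ∀ {V} (h : Fin V → Fin 2) w → flipAt h w w ≡ otherState (h w)
flipAt-at h w rewrite ==-refl w = refl

module _ {n : ℕ} (t : PhyloTree n) where

  mutation : ∀ {k} → (Fin (Vtx t) → Fin k) → Fin (Vtx t) → Fin (Vtx t) → Bool
  mutation h u v = adj t u v ∧ not (h u == h v)

  orderedMutation : ∀ {k} → (Fin (Vtx t) → Fin k) → Fin (Vtx t) × Fin (Vtx t) → Bool
  orderedMutation h (u , v) = precedes u v ∧ mutation h u v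

  module _ {k : ℕ} (h : Fin (Vtx t) → Fin k) where

    changes≡countᵇ : changes t h ≡ countᵇ (orderedMutation h) (allPairs (Vtx t))
    changes≡countᵇ = trans (length-filterᵇ _ (allPairs (Vtx t))) (countᵇ-cong (λ _ → refl) (allPairs (Vtx t)))

    mutation-sym : ∀ u v → mutation h u v ≡ mutation h v u
    mutation-sym u v rewrite adj-sym t u v | ==-sym (h u) (h v) = refl

    changes-split : ∀ w → changes t h ≡
      countᵇ (mutation h w) (allFin (Vtx t)) +
      countᵇ (λ e → orderedMutation h e ∧ not (touches w e)) (allPairs (Vtx t))
    changes-split w = begin
        changes t h
      ≡⟨ trans changes≡countᵇ (countᵇ-split (orderedMutation h) (touches w) (allPairs (Vtx t))) ⟩
        countᵇ (λ e → orderedMutation h e ∧ touches w e) (allPairs (Vtx t)) + away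
      ≡⟨ cong (_+ away) (countᵇ-touching (orderedMutation h) w no-loop) ⟩
        countᵇ (λ v → precedes w v ∧ mutation h w v) (allFin (Vtx t)) +
        countᵇ (λ u → precedes u w ∧ mutation h u w) (allFin (Vtx t)) + away
      ≡⟨ cong (_+ away) (cong₂ _+_ (countᵇ-cong (λ v → ∧-comm (precedes w v) _) (allFin (Vtx t)))
                                   (countᵇ-cong incoming (allFin (Vtx t)))) ⟩
        countᵇ (λ v → mutation h w v ∧ precedes w v) (allFin (Vtx t)) +
        countᵇ (λ v → mutation h w v ∧ not (precedes w v)) (allFin (Vtx t)) + away
      ≡⟨ cong (_+ away) (countᵇ-split (mutation h w) (precedes w) (allFin (Vtx t))) ⟨
        countᵇ (mutation h w) (allFin (Vtx t)) + away
      ∎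
      where
      open ≡-Reasoning
      away = countᵇ (λ e → orderedMutation h e ∧ not (touches w e)) (allPairs (Vtx t))
      no-loop : orderedMutation h (w , w) ≡ false
      no-loop rewrite adj-irr t w = ∧-zeroʳ _
      incoming : ∀ u → precedes u w ∧ mutation h u w ≡ mutation h w u ∧ not (precedes w u)
      incoming u with u ≟ w
      ... | yes refl rewrite adj-irr t u = ∧-zeroʳ _
      ... | no u≢w rewrite precedes-flip (u≢w ∘ sym) | mutation-sym u w = ∧-comm (precedes u w) _

  module _ (h : Fin (Vtx t) → Fin 2) (w : Fin (Vtx t)) where

    sameStateNeighbours : ℕ
    sameStateNeighbours = countᵇ (λ v → adj t w v ∧ (h w == h v)) (allFin (Vtx t))

    mutations-flipAt : countᵇ (mutation (flipAt h w) w) (allFin (Vtx t)) ≡ sameStateNeighbours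
    mutations-flipAt = countᵇ-cong (λ v → flipped v (v ≟ w)) (allFin (Vtx t))
      where
      flipped : ∀ v → Dec (v ≡ w) → mutation (flipAt h w) w v ≡ adj t w v ∧ (h w == h v)
      flipped v (yes refl) rewrite adj-irr t v = refl
      flipped v (no v≢w) = begin
          adj t w v ∧ not (flipAt h w w == flipAt h w v)
        ≡⟨ cong₂ (λ a b → adj t w v ∧ not (a == b)) (flipAt-at h w) (flipAt-away h v≢w) ⟩
          adj t w v ∧ not (otherState (h w) == h v)
        ≡⟨ cong (adj t w v ∧_) (not-otherState-== (h w) (h v)) ⟩
          adj t w v ∧ (h w == h v)
        ∎
        where open ≡-Reasoning

    away-flipAt : ∀ e → orderedMutation (flipAt h w) e ∧ not (touches w e) ≡ orderedMutation h e ∧ not (touches w e)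
    away-flipAt (u , v) with u ≟ w | v ≟ w
    ... | yes refl | _ = trans (∧-zeroʳ _) (sym (∧-zeroʳ _))
    ... | no _ | yes refl = trans (∧-zeroʳ _) (sym (∧-zeroʳ _))
    ... | no _ | no _ = refl

    degree≡sameStateNeighbours+mutations :
      degree (adj t) w ≡ sameStateNeighbours + countᵇ (mutation h w) (allFin (Vtx t))
    degree≡sameStateNeighbours+mutations =
      trans (length-filterᵇ (adj t w) (allFin (Vtx t))) (countᵇ-split (adj t w) (λ v → h w == h v) (allFin (Vtx t)))

    flipAt-decreases-changes : degree (adj t) w ≡ 3 → sameStateNeighbours ≤ 1 → changes t (flipAt h w) < changes t h
    flipAt-decreases-changes deg≡3 same≤1
      rewrite changes-split (flipAt h w) w | changes-split h w | mutations-flipAt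
            | countᵇ-cong away-flipAt (allPairs (Vtx t)) =
      +-monoˡ-< _ (fewer-than-rest same≤1 (trans (sym degree≡sameStateNeighbours+mutations) deg≡3))
      where
      fewer-than-rest : ∀ {s d} → s ≤ 1 → s + d ≡ 3 → s < d
      fewer-than-rest {zero} _ refl = s≤s z≤n
      fewer-than-rest {suc zero} _ refl = s≤s (s≤s z≤n)
      fewer-than-rest {suc (suc _)} (s≤s ()) _

foldr-⊓-≤ : ∀ {A : Set} (c : A → ℕ) base (xs : List A) {x} → x ∈ xs → foldr (λ y acc → c y ⊓ acc) base xs ≤ c x
foldr-⊓-≤ c base (y ∷ xs) (here refl) = m⊓n≤m (c y) _
foldr-⊓-≤ c base (y ∷ xs) (there x∈xs) = ≤-trans (m⊓n≤n (c y) _) (foldr-⊓-≤ c base xs x∈xs)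

∈-allVecs : ∀ m (v : Vec (Fin 2) m) → v ∈ allVecs m
∈-allVecs zero [] = here refl
∈-allVecs (suc m) (zero ∷ v) = ∈-++⁺ˡ (∈-map⁺ (zero ∷_) (∈-allVecs m v))
∈-allVecs (suc m) (suc zero ∷ v) =
  ∈-++⁺ʳ (map (zero ∷_) (allVecs m)) (∈-++⁺ˡ (∈-map⁺ (suc zero ∷_) (∈-allVecs m v)))

leaf≢internal : ∀ {n m} (i : Fin n) (j : Fin m) → i ↑ˡ m ≢ n ↑ʳ j
leaf≢internal {n} {m} i j eq with trans (sym (splitAt-↑ˡ n i m)) (trans (cong (splitAt n) eq) (splitAt-↑ʳ n m j))
... | ()

module _ {n : ℕ} (t : PhyloTree n) where

  changes-cong : ∀ {k} {h h′ : Fin (Vtx t) → Fin k} → (∀ u → h u ≡ h′ u) → changes t h ≡ changes t h′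
  changes-cong {h = h} {h′} h≗h′ =
    trans (changes≡countᵇ t h) (trans (countᵇ-cong same (allPairs (Vtx t))) (sym (changes≡countᵇ t h′)))
    where
    same : ∀ e → orderedMutation t h e ≡ orderedMutation t h′ e
    same (u , v) rewrite h≗h′ u | h≗h′ v = refl

  extend-internalStates : ∀ {f h} → IsExtension t f h →
    ∀ u → extend t f (tabulate (λ j → h (n ↑ʳ j))) u ≡ h u
  extend-internalStates {f} {h} h-ext u with splitAt n u in split≡
  ... | inj₁ i = trans (sym (h-ext i)) (cong h (splitAt⁻¹-↑ˡ split≡))
  ... | inj₂ j = trans (lookup∘tabulate (λ j → h (n ↑ʳ j)) j) (cong h (splitAt⁻¹-↑ʳ split≡))

  score≤changes : ∀ {f h} → IsExtension t f h → score t f ≤ changes t h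
  score≤changes {f} {h} h-ext = ≤-trans
    (foldr-⊓-≤ (λ v → changes t (extend t f v)) _ (allVecs (m t)) (∈-allVecs (m t) (tabulate (λ j → h (n ↑ʳ j)))))
    (≤-reflexive (changes-cong (extend-internalStates h-ext)))

  module _ {f : Fin n → Fin 2} {h : Fin (Vtx t) → Fin 2} (h-opt : IsOptimal t f h) (j : Fin (m t)) where

    private
      w : Fin (Vtx t)
      w = n ↑ʳ j

    flipAt-internal-extension : IsExtension t f (flipAt h w)
    flipAt-internal-extension i = trans (flipAt-away h (leaf≢internal i j)) (proj₁ h-opt i)

    optimal⇒anotherSameStateNeighbour : ∀ v → ∃[ u ] (Edge t w u × h w ≡ h u × u ≢ v)
    optimal⇒anotherSameStateNeighbour v
      with any? (λ u → T? (adj t w u) ×-dec (h w ≟ h u) ×-dec ¬? (u ≟ v))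
    ... | yes found = found
    ... | no none = ⊥-elim (<⇒≱ (flipAt-decreases-changes t h w (innerDeg t j) same≤1)
                               (≤-trans (≤-reflexive (proj₂ h-opt)) (score≤changes flipAt-internal-extension)))
      where
      only-v : ∀ u → T (adj t w u ∧ (h w == h u)) → T (u == v)
      only-v u adj∧same with Equivalence.to (T-∧ {adj t w u}) adj∧same | u ≟ v
      ... | _ | yes _ = _
      ... | w~u , same | no u≢v = ⊥-elim (none (u , w~u , toWitness same , u≢v))
      same≤1 : sameStateNeighbours t h w ≤ 1
      same≤1 = ≤-trans (countᵇ-mono only-v (allFin (Vtx t))) (≤-reflexive (countᵇ-allFin-== v))

module _ {V : ℕ} {E : Fin V → Fin V → Set} {S : Fin V → Set} where

  walk-++ : ∀ {u v w} → Walk E S u v → Walk E S v w → Walk E S u w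
  walk-++ (here _) q = q
  walk-++ (step s e p) q = step s e (walk-++ p q)

  walk-last : ∀ {u v} → Walk E S u v → S v
  walk-last (here s) = s
  walk-last (step _ _ p) = walk-last p

  walk-snoc : ∀ {u v w} → Walk E S u v → E v w → S w → Walk E S u w
  walk-snoc p e s = walk-++ p (step (walk-last p) e (here s))

  walk-reverse : (∀ {a b} → E a b → E b a) → ∀ {u v} → Walk E S u v → Walk E S v u
  walk-reverse E-sym (here s) = here s
  walk-reverse E-sym (step s e p) = walk-snoc (walk-reverse E-sym p) (E-sym e) s

  walk-exit : (B : Fin V → Bool) → ∀ {a b} → Walk E S a b → ¬ T (B a) → T (B b) →
    ∃₂ λ q p → Walk E S a q × E q p × ¬ T (B q) × T (B p)
  walk-exit B (here _) a∉B b∈B = ⊥-elim (a∉B b∈B)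
  walk-exit B {a} (step {w = c} s e rest) a∉B b∈B with T? (B c)
  ... | yes c∈B = a , c , here s , e , a∉B , c∈B
  ... | no c∉B with walk-exit B rest c∉B b∈B
  ...   | q , p , c~q , exit = q , p , step s e c~q , exit

walk-map : ∀ {V} {E E′ : Fin V → Fin V → Set} {S S′ : Fin V → Set} →
  (∀ {a b} → E a b → E′ a b) → (∀ {a} → S a → S′ a) → ∀ {u v} → Walk E S u v → Walk E′ S′ u v
walk-map f g (here s) = here (g s)
walk-map f g (step s e p) = step (g s) (f e) (walk-map f g p)

data Distinct {A : Set} : List A → Set where
  [] : Distinct []
  _∷_ : ∀ {x xs} → x ∉ xs → Distinct xs → Distinct (x ∷ xs)

module _ {A : Set} where

  Distinct-++ : ∀ {xs ys : List A} → Distinct xs → Distinct ys → (∀ {y} → y ∈ xs → y ∉ ys) → Distinct (xs ++ ys)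
  Distinct-++ [] ys-distinct disjoint = ys-distinct
  Distinct-++ {x ∷ xs} (x∉xs ∷ xs-distinct) ys-distinct disjoint =
    [ x∉xs , disjoint (here refl) ]′ ∘ ∈-++⁻ xs ∷ Distinct-++ xs-distinct ys-distinct (disjoint ∘ there)

  Distinct-++⁻ : ∀ (xs : List A) {ys} → Distinct (xs ++ ys) → Distinct xs × Distinct ys
  Distinct-++⁻ [] d = [] , d
  Distinct-++⁻ (x ∷ xs) (x∉ ∷ d) = (x∉ ∘ ∈-++⁺ˡ) ∷ proj₁ (Distinct-++⁻ xs d) , proj₂ (Distinct-++⁻ xs d)

  Distinct-lookup-injective : ∀ {xs : List A} → Distinct xs → ∀ i j → lookup xs i ≡ lookup xs j → i ≡ j
  Distinct-lookup-injective (_ ∷ _) zero zero _ = refl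
  Distinct-lookup-injective (x∉ ∷ _) zero (suc j) eq = ⊥-elim (x∉ (subst (_∈ _) (sym eq) (∈-lookup j)))
  Distinct-lookup-injective (x∉ ∷ _) (suc i) zero eq = ⊥-elim (x∉ (subst (_∈ _) eq (∈-lookup i)))
  Distinct-lookup-injective (_ ∷ d) (suc i) (suc j) eq = cong suc (Distinct-lookup-injective d i j eq)

Distinct⇒length≤ : ∀ {V} {xs : List (Fin V)} → Distinct xs → length xs ≤ V
Distinct⇒length≤ d = injective⇒≤ (λ {i} {j} → Distinct-lookup-injective d i j)

1≤length-++-∷ : ∀ {A : Set} (xs : List A) {y ys} → 1 ≤ length (xs ++ y ∷ ys)
1≤length-++-∷ [] = s≤s z≤n
1≤length-++-∷ (_ ∷ _) = s≤s z≤n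

data Path {V : ℕ} (E : Fin V → Fin V → Set) : Fin V → Fin V → List (Fin V) → Set where
  end : ∀ {a} → Path E a a (a ∷ [])
  _∷_ : ∀ {a b c ℓ} → E a b → Path E b c ℓ → Path E a c (a ∷ ℓ)

module _ {V : ℕ} {E : Fin V → Fin V → Set} where

  open import Data.List.Membership.DecPropositional (_≟_ {n = V}) using (_∈?_)

  path-++ : ∀ {a b c ℓ ℓ′} → Path E a b ℓ → Path E b c (b ∷ ℓ′) → Path E a c (ℓ ++ ℓ′)
  path-++ end q = q
  path-++ (e ∷ p) q = e ∷ path-++ p q

  path-target-∈ : ∀ {a b ℓ} → Path E a b ℓ → b ∈ ℓ
  path-target-∈ end = here refl
  path-target-∈ (_ ∷ p) = there (path-target-∈ p)

  path-split : ∀ {a b ℓ y} → Path E a b ℓ → y ∈ ℓ →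
    ∃₂ λ ℓ₁ ℓ₂ → ℓ ≡ ℓ₁ ++ y ∷ ℓ₂ × Path E a y (ℓ₁ ++ y ∷ []) × Path E y b (y ∷ ℓ₂)
  path-split end (here refl) = [] , [] , refl , end , end
  path-split (e ∷ p) (here refl) = [] , _ , refl , end , e ∷ p
  path-split {a} (e ∷ p) (there y∈) with path-split p y∈
  ... | ℓ₁ , ℓ₂ , refl , p₁ , p₂ = a ∷ ℓ₁ , ℓ₂ , refl , e ∷ p₁ , p₂

  path-edge : ∀ {a b x xs} → Path E a b (x ∷ xs) → ∀ i → E (lookup (x ∷ xs) (inject₁ i)) (lookup (x ∷ xs) (suc i))
  path-edge (e ∷ end) zero = e
  path-edge (e ∷ (_ ∷ _)) zero = e
  path-edge (_ ∷ p@(_ ∷ _)) (suc i) = path-edge p i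

  path-last : ∀ {a b x xs} → Path E a b (x ∷ xs) → lookup (x ∷ xs) (fromℕ (length xs)) ≡ b
  path-last end = refl
  path-last (_ ∷ end) = refl
  path-last (_ ∷ p@(_ ∷ _)) = path-last p

  walk⇒path : ∀ {S : Fin V → Set} {a b} → Walk E S a b →
    ∃ λ ℓ → Path E a b ℓ × Distinct ℓ × (∀ {y} → y ∈ ℓ → S y)
  walk⇒path (here s) = _ , end , (λ ()) ∷ [] , λ { (here refl) → s }
  walk⇒path {a = a} (step s e p) with walk⇒path p
  ... | ℓ , q , ℓ-distinct , all-S with a ∈? ℓ
  ...   | no a∉ℓ = a ∷ ℓ , e ∷ q , a∉ℓ ∷ ℓ-distinct , λ { (here refl) → s ; (there y∈) → all-S y∈ }
  ...   | yes a∈ℓ with path-split q a∈ℓ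
  ...     | ℓ₁ , ℓ₂ , refl , _ , q₂ = a ∷ ℓ₂ , q₂ , proj₂ (Distinct-++⁻ ℓ₁ ℓ-distinct) , all-S ∘ ∈-++⁺ʳ ℓ₁

module _ {n : ℕ} (t : PhyloTree n) where

  edge-sym : ∀ {a b} → Edge t a b → Edge t b a
  edge-sym {a} {b} = subst T (adj-sym t a b)

  no-cycle : ∀ {a b ℓ} → Path (Edge t) a b ℓ → Distinct ℓ → 3 ≤ length ℓ → ¬ Edge t b a
  no-cycle {a} {b} {x₀ ∷ x₁ ∷ x₂ ∷ xs} p ℓ-distinct (s≤s (s≤s (s≤s z≤n))) b~a =
    acyclic t (length xs) (lookup ℓ)
      ( (λ {i} {j} → Distinct-lookup-injective ℓ-distinct i j)
      , path-edge p
      , subst₂ (Edge t) (sym (path-last p)) (path-head p) b~a )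
    where
    ℓ = x₀ ∷ x₁ ∷ x₂ ∷ xs
    path-head : ∀ {a b x xs} → Path (Edge t) a b (x ∷ xs) → a ≡ x
    path-head end = refl
    path-head (_ ∷ _) = refl

module Reachability {V : ℕ} (E : Fin V → Fin V → Bool) (target : Fin V) where

  Eᵀ : Fin V → Fin V → Set
  Eᵀ a b = T (E a b)

  reachesWithin : ℕ → Fin V → Bool
  reachesWithin zero v = v == target
  reachesWithin (suc k) v = reachesWithin k v ∨ ⌊ any? (λ u → T? (E v u ∧ reachesWithin k u)) ⌋

  -- V steps suffice: every walk shortens to a simple path, which has at most V vertices.
  reaches : Fin V → Bool
  reaches = reachesWithin V

  reachesWithin-sound : ∀ k {v} → T (reachesWithin k v) → Walk Eᵀ Everything v target
  reachesWithin-sound zero v≡target rewrite toWitness {a? = _ ≟ target} v≡target = here true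
  reachesWithin-sound (suc k) {v} r with Equivalence.to (T-∨ {reachesWithin k v}) r
  ... | inj₁ r′ = reachesWithin-sound k r′
  ... | inj₂ found with toWitness found
  ...   | u , v~u∧r with Equivalence.to (T-∧ {E v u}) v~u∧r
  ...     | v~u , u-r = step true v~u (reachesWithin-sound k u-r)

  reachesWithin-suc : ∀ {k v} → T (reachesWithin k v) → T (reachesWithin (suc k) v)
  reachesWithin-suc r = Equivalence.from T-∨ (inj₁ r)

  reachesWithin-step : ∀ {k u v} → T (E v u) → T (reachesWithin k u) → T (reachesWithin (suc k) v)
  reachesWithin-step {k} {u} {v} v~u u-r =
    Equivalence.from (T-∨ {reachesWithin k v}) (inj₂ (fromWitness (u , Equivalence.from T-∧ (v~u , u-r))))

  reachesWithin-mono : ∀ {k k′ v} → k ≤′ k′ → T (reachesWithin k v) → T (reachesWithin k′ v)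
  reachesWithin-mono ≤′-refl r = r
  reachesWithin-mono (≤′-step {k′} k≤k′) r = reachesWithin-suc {k′} (reachesWithin-mono k≤k′ r)

  path-reachesWithin : ∀ {v ℓ} → Path Eᵀ v target ℓ → T (reachesWithin (length ℓ) v)
  path-reachesWithin end = reachesWithin-suc {0} (fromWitness {a? = target ≟ target} refl)
  path-reachesWithin {ℓ = _ ∷ ℓ} (v~u ∷ p) = reachesWithin-step {length ℓ} v~u (path-reachesWithin p)

  reaches-complete : ∀ {S v} → Walk Eᵀ S v target → T (reaches v)
  reaches-complete w with walk⇒path w
  ... | _ , p , ℓ-distinct , _ = reachesWithin-mono (≤⇒≤′ (Distinct⇒length≤ ℓ-distinct)) (path-reachesWithin p)

module _ {n k : ℕ} (t : PhyloTree n) (h : Fin (Vtx t) → Fin k) where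

  sameStateEdge : Fin (Vtx t) → Fin (Vtx t) → Bool
  sameStateEdge a b = adj t a b ∧ (h a == h b)

  inComponentOf : Fin (Vtx t) → Fin (Vtx t) → Bool
  inComponentOf = Reachability.reaches sameStateEdge

  SameComp-sym : ∀ {u v} → SameComp t h u v → SameComp t h v u
  SameComp-sym = walk-reverse λ (e , same) → edge-sym t e , sym same

  inComponentOf-sound : ∀ {a v} → T (inComponentOf a v) → SameComp t h v a
  inComponentOf-sound {a} r =
    walk-map from-T-sameStateEdge (λ s → s) (Reachability.reachesWithin-sound sameStateEdge a (Vtx t) r)
    where
    from-T-sameStateEdge : ∀ {u v} → T (sameStateEdge u v) → Edge t u v × h u ≡ h v
    from-T-sameStateEdge {u} e with Equivalence.to (T-∧ {adj t u _}) e
    ... | u~v , same = u~v , toWitness same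

  inComponentOf-complete : ∀ {a v} → SameComp t h v a → T (inComponentOf a v)
  inComponentOf-complete {a} =
    Reachability.reaches-complete sameStateEdge a ∘ walk-map to-T-sameStateEdge (λ s → s)
    where
    to-T-sameStateEdge : ∀ {u v} → Edge t u v × h u ≡ h v → T (sameStateEdge u v)
    to-T-sameStateEdge (u~v , same) = Equivalence.from T-∧ (u~v , fromWitness same)

  inComponentOf-connected : ∀ a → ConnectedSet t (inComponentOf a)
  inComponentOf-connected a u v u∈ v∈ =
    within-component (walk-++ (inComponentOf-sound u∈) (SameComp-sym (inComponentOf-sound v∈))) (inComponentOf-sound u∈)
    where
    within-component : ∀ {w z} → SameComp t h w z → SameComp t h w a → Walk (Edge t) (λ y → T (inComponentOf a y)) w z
    within-component (here _) w~a = here (inComponentOf-complete w~a)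
    within-component (step _ (w~y , same) rest) w~a =
      step (inComponentOf-complete w~a) w~y (within-component rest (step true (edge-sym t w~y , sym same) w~a))

  inSpan⇒SameComp : ∀ {x v} → InSpan t (componentPartition t h) x v → SameComp t h (leaf t x) v
  inSpan⇒SameComp {x} x-span =
    SameComp-sym (inComponentOf-sound (x-span (inComponentOf (leaf t x)) (inComponentOf-connected (leaf t x))
                                        (λ y x~y → inComponentOf-complete (SameComp-sym x~y))))

  componentPartition-convex : Convex t (componentPartition t h)
  componentPartition-convex x y v x-span y-span =
    walk-++ (inSpan⇒SameComp x-span) (SameComp-sym (inSpan⇒SameComp y-span))

module _ {n : ℕ} (t : PhyloTree n) {S : Fin (Vtx t) → Bool} (S-connected : ConnectedSet t S)
         {p : Fin (Vtx t)} (p∈S : T (S p)) where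

  record EscapingPath (w : Fin (Vtx t)) : Set where
    field
      next : Fin (Vtx t)
      rest : List (Fin (Vtx t))
      path : Path (Edge t) w p (w ∷ next ∷ rest)
      distinct : Distinct (w ∷ next ∷ rest)
      only-p-inside : ∀ {y} → y ∈ w ∷ next ∷ rest → T (S y) → y ≡ p
      start-outside : ¬ T (S w)

    vertices : List (Fin (Vtx t))
    vertices = w ∷ next ∷ rest

  open EscapingPath

  module _ {w u} (e : EscapingPath w) (w~u : Edge t w u) (u≢next : u ≢ next e) where

    escape-∉ : u ∉ vertices e
    escape-∉ u∈ with path-split (path e) u∈
    ... | ℓ₁ , ℓ₂ , vertices≡ , prefix , _ =
      no-cycle t prefix (proj₁ (Distinct-++⁻ (ℓ₁ ++ u ∷ []) prefix-distinct)) (long-enough ℓ₁ vertices≡) (edge-sym t w~u)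
      where
      prefix-distinct : Distinct ((ℓ₁ ++ u ∷ []) ++ ℓ₂)
      prefix-distinct = subst Distinct (trans vertices≡ (sym (++-assoc ℓ₁ (u ∷ []) ℓ₂))) (distinct e)
      long-enough : ∀ ℓ₁ → vertices e ≡ ℓ₁ ++ u ∷ ℓ₂ → 3 ≤ length (ℓ₁ ++ u ∷ [])
      long-enough [] refl = ⊥-elim (subst T (adj-irr t w) w~u)
      long-enough (_ ∷ []) refl = ⊥-elim (u≢next refl)
      long-enough (_ ∷ _ ∷ ℓ) _ = s≤s (s≤s (1≤length-++-∷ ℓ))

    escape-outside : ¬ T (S u)
    escape-outside u∈S with walk⇒path (S-connected p u p∈S u∈S)
    ... | _ ∷ [] , end , _ , _ = escape-∉ (path-target-∈ (path e))
    ... | _ ∷ ℓ@(_ ∷ _) , q@(_ ∷ _) , p∉ℓ ∷ ℓ-distinct , all-S =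
      no-cycle t (path-++ (path e) q) (Distinct-++ (distinct e) ℓ-distinct disjoint)
               (s≤s (s≤s (1≤length-++-∷ (rest e)))) (edge-sym t w~u)
      where
      disjoint : ∀ {y} → y ∈ vertices e → y ∉ ℓ
      disjoint y∈ y∈ℓ = p∉ℓ (subst (_∈ ℓ) (only-p-inside e y∈ (all-S (there y∈ℓ))) y∈ℓ)

  escape-further : ∀ {w u} (e : EscapingPath w) → Edge t w u → u ≢ next e → EscapingPath u
  escape-further {w} e w~u u≢next = record
    { next = w
    ; rest = next e ∷ rest e
    ; path = edge-sym t w~u ∷ path e
    ; distinct = escape-∉ e w~u u≢next ∷ distinct e
    ; only-p-inside = λ { (here refl) u∈S → ⊥-elim (escape-outside e w~u u≢next u∈S)
                        ; (there y∈) → only-p-inside e y∈ }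
    ; start-outside = escape-outside e w~u u≢next
    }

module _ {n : ℕ} (t : PhyloTree n) {f : Fin n → Fin 2} {h : Fin (Vtx t) → Fin 2} (h-opt : IsOptimal t f h)
         {S : Fin (Vtx t) → Bool} (S-connected : ConnectedSet t S)
         {x : Fin n} (block⊆S : ∀ y → SameComp t h (leaf t x) (leaf t y) → T (S (leaf t y))) where

  outside-internal : ∀ {w} → SameComp t h (leaf t x) w → ¬ T (S w) → ∃[ j ] w ≡ n ↑ʳ j
  outside-internal {w} x~w w∉S with splitAt n w in split≡
  ... | inj₁ i rewrite sym (splitAt⁻¹-↑ˡ split≡) = ⊥-elim (w∉S (block⊆S i x~w))
  ... | inj₂ j = j , sym (splitAt⁻¹-↑ʳ split≡)

  escape-impossible : ∀ fuel {p} {p∈S : T (S p)} {w} → SameComp t h (leaf t x) w →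
    (e : EscapingPath t S-connected p∈S w) → Vtx t < length (EscapingPath.vertices e) + fuel → ⊥
  escape-impossible zero _ e V< =
    <⇒≱ V< (≤-trans (≤-reflexive (+-identityʳ _)) (Distinct⇒length≤ (EscapingPath.distinct e)))
  escape-impossible (suc fuel) x~w e V< with outside-internal x~w (EscapingPath.start-outside e)
  ... | j , refl with optimal⇒anotherSameStateNeighbour t h-opt j (EscapingPath.next e)
  ...   | u , w~u , same , u≢next =
    escape-impossible fuel (walk-snoc x~w (w~u , same) true) (escape-further t S-connected _ e w~u u≢next)
                      (subst (Vtx t <_) (+-suc _ fuel) V<)

  component⊆S : ∀ {v} → SameComp t h (leaf t x) v → T (S v)
  component⊆S {v} x~v with T? (S v)
  ... | yes v∈S = v∈S
  ... | no v∉S with walk-exit S (SameComp-sym t h x~v) v∉S (block⊆S x (here true))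
  ...   | q , p , v~q , (q~p , same) , q∉S , p∈S =
    ⊥-elim (escape-impossible (Vtx t) (walk-++ x~v v~q) first-step (s≤s (n≤1+n (Vtx t))))
    where
    first-step : EscapingPath t S-connected p∈S q
    first-step = record
      { next = p
      ; rest = []
      ; path = q~p ∷ end
      ; distinct = (λ { (here refl) → q∉S p∈S }) ∷ (λ ()) ∷ []
      ; only-p-inside = λ { (here refl) q∈S → ⊥-elim (q∉S q∈S) ; (there (here refl)) _ → refl }
      ; start-outside = q∉S
      }

optimal⇒component⊆span : ∀ {n} (t : PhyloTree n) {f h} → IsOptimal t f h →
  ∀ {x v} → SameComp t h (leaf t x) v → InSpan t (componentPartition t h) x v
optimal⇒component⊆span t h-opt x~v S S-connected block⊆S = component⊆S t h-opt S-connected block⊆S x~v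

mainTheorem16 : ∀ {n : ℕ} (T T′ : PhyloTree n) (f₂ : Fin n → Fin 2) →
  IsSurjective f₂ → AttainsDMP2 T T′ f₂ →
  (T* : PhyloTree n) → (T* ≡ T ⊎ T* ≡ T′) →
  (g₂ : Fin (Vtx T*) → Fin 2) → IsOptimal T* f₂ g₂ →
  ComponentsHaveTwoTaxa T* g₂ →
  Convex T* (componentPartition T* g₂) × NaturalCovering T* (componentPartition T* g₂)
mainTheorem16 _ _ _ _ _ T* _ g₂ g₂-optimal two-taxa =
  componentPartition-convex T* g₂ , covering
  where
  covering : NaturalCovering T* (componentPartition T* g₂)
  covering v with two-taxa v
  ... | x , _ , _ , v~x , _ = x , optimal⇒component⊆span T* g₂-optimal (SameComp-sym T* g₂ v~x)
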